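{- Let $n, q \in \mathbb N$ with $n$ odd and $q > 2$, let $\zeta$ be a primitive complex $q$th root of unity, let $H \in \mathcal H_n(q)$, and let $A = (J-H)/(1-\zeta)$. Then $\det (A) \in (1-\zeta) \mathbb Z[\zeta]$.
   Context: $\mathcal H_n(q)$ is the set of Hermitean $n\times n$ matrices all of whose entries are powers of $\zeta$. $J$ is the all-ones matrix. -}

module Defs where

open import Level using (Level; _⊔_)
open import Data.Nat using (ℕ; zero; suc; _<_)
open import Data.Integer using (ℤ; +_; -[1+_])
open import Data.List using (List; []; _∷_)
open import Data.Fin using (Fin; zero; suc; punchIn)
open import Data.Product using (∃; Σ; _×_)
open import Data.Sum using (_⊎_)
open import Relation.Nullary using (¬_)
open import Relation.Binary.PropositionalEquality using (_≡_)
open import Algebra.Bundles using (CommutativeRing)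

Odd : ℕ → Set
Odd n = ∃ λ k → n ≡ suc (k Data.Nat.+ k)

module _ {c ℓ : Level} (R : CommutativeRing c ℓ) where
  open CommutativeRing R hiding (zero)

  pow : Carrier → ℕ → Carrier
  pow x zero = 1#
  pow x (suc k) = x * pow x k

  natR : ℕ → Carrier
  natR zero = 0#
  natR (suc m) = 1# + natR m

  intR : ℤ → Carrier
  intR (+ m) = natR m
  intR -[1+ m ] = - natR (suc m)

  -- evaluation of an integer polynomial (coefficient list, constant term first)
  evalPoly : List ℤ → Carrier → Carrier
  evalPoly [] x = 0#
  evalPoly (a ∷ as) x = intR a + x * evalPoly as x

  InZζ : Carrier → Carrier → Set ℓ
  InZζ ζ y = Σ (List ℤ) λ p → y ≈ evalPoly p ζ

  InIdeal : Carrier → Carrier → Set ℓ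
  InIdeal ζ y = Σ (List ℤ) λ p → y ≈ (1# - ζ) * evalPoly p ζ

  CharZero : Set ℓ
  CharZero = ∀ m → ¬ (natR (suc m) ≈ 0#)

  NoZeroDivisors : Set (c ⊔ ℓ)
  NoZeroDivisors = ∀ x y → x * y ≈ 0# → (x ≈ 0#) ⊎ (y ≈ 0#)

  PrimitiveRoot : ℕ → Carrier → Set ℓ
  PrimitiveRoot q ζ = (pow ζ q ≈ 1#) × (∀ k → 0 < k → k < q → ¬ (pow ζ k ≈ 1#))

  sumFin : (n : ℕ) → (Fin n → Carrier) → Carrier
  sumFin zero f = 0#
  sumFin (suc n) f = f zero + sumFin n (λ i → f (suc i))

  sign : ℕ → Carrier
  sign zero = 1#
  sign (suc k) = - sign k

  det : (n : ℕ) → (Fin n → Fin n → Carrier) → Carrier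
  det zero M = 1#
  det (suc n) M =
    sumFin (suc n) (λ j → sign (Data.Fin.toℕ j) * (M zero j * det n (λ i k → M (suc i) (punchIn j k))))

  -- H ∈ 𝓗_n(q): every entry is a power of ζ, and H is Hermitian.
  -- For an entry ζ^k (of modulus 1) its complex conjugate is ζ^(-k) = (ζ^k)⁻¹,
  -- so Hermitian means H j i = conj (H i j), i.e. H j i * ζ^k = 1 whenever H i j = ζ^k.
  InH : (n q : ℕ) → Carrier → (Fin n → Fin n → Carrier) → Set ℓ
  InH n q ζ H =
    (∀ i j → ∃ λ k → H i j ≈ pow ζ k) ×
    (∀ i j k → H i j ≈ pow ζ k → H j i * pow ζ k ≈ 1#)

-- Write H i j = ζ ^ k. Then A i j is the geometric sum 1 + ζ + ⋯ + ζ ^ (k - 1), an element of ℤ[ζ].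
-- Hermiticity gives ζ ^ (k + k′) = 1 for the exponent k′ of H j i, so the geometric sum of length
-- k + k′ vanishes and A i j + A j i ∈ (1 - ζ) ℤ[ζ]. On the diagonal ζ ^ (2k) = 1, and as ζ² ≠ 1
-- (this is where q > 2 enters) the sum 1 + ζ² + ⋯ + ζ^(2(k-1)) vanishes; it is congruent to A i i
-- modulo 1 - ζ. Hence A is congruent to a skew-symmetric matrix over ℤ[ζ], whose determinant d
-- satisfies d = - d in odd dimension and so is 0, since 2 ≠ 0 in a domain of characteristic zero.
module Submission where

open import Level using (Level)
open import Data.Nat as ℕ using (ℕ; zero; suc; _<_; s≤s; z≤n)
open import Data.Nat.Properties using (+-suc; <-trans)
open import Data.Integer as ℤ using (ℤ; +_; -[1+_])
import Data.Integer.Properties as ℤ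
open import Data.Fin using (Fin; zero; suc; punchIn; toℕ)
open import Data.List using (List; []; _∷_)
open import Data.Maybe using (Maybe; just; nothing)
open import Data.Product using (_,_; proj₁; proj₂)
open import Data.Sum using (inj₁; inj₂)
open import Data.Empty using (⊥-elim)
open import Relation.Nullary using (¬_; yes; no)
open import Relation.Binary.PropositionalEquality as ≡ using (_≡_)
open import Algebra.Bundles using (CommutativeRing)
import Algebra.Solver.Ring as RingSolver
open import Algebra.Solver.Ring.AlmostCommutativeRing
  using (_-Raw-AlmostCommutative⟶_; fromCommutativeRing)
open import Defs

module _ {c ℓ : Level} (R : CommutativeRing c ℓ) where
  open CommutativeRing R hiding (zero)
  open import Algebra.Properties.Ring ring using (-‿distribˡ-*; -‿distribʳ-*; -1*x≈-x)
  open import Algebra.Properties.AbelianGroup +-abelianGroup using (⁻¹-∙-comm; xyx⁻¹≈y)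
  open import Algebra.Properties.Group +-group
    using (ε⁻¹≈ε; ⁻¹-involutive; x∙y⁻¹≈ε⇒x≈y; x≈y⇒x∙y⁻¹≈ε)
  open import Algebra.Properties.Monoid.Mult +-monoid using (_×_; ×-homo-+)
  open import Algebra.Properties.Semiring.Mult semiring using (×1-homo-*)
  open import Algebra.Properties.Semiring.Sum semiring
    using (sum; sum-syntax; sum-cong-≋; sum-cong-≗; *-distribˡ-sum; ∑-comm)
  open import Algebra.Properties.CommutativeSemiring.Exp commutativeSemiring
    using (_^_; ^-homo-*; ^-distrib-*)
  open import Relation.Binary.Reasoning.Setoid setoid

  natR≈×1# : ∀ m → natR R m ≈ m × 1#
  natR≈×1# zero = refl
  natR≈×1# (suc m) = +-congˡ (natR≈×1# m)

  natR-homo-+ : ∀ m n → natR R (m ℕ.+ n) ≈ natR R m + natR R n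
  natR-homo-+ m n = begin
    natR R (m ℕ.+ n)      ≈⟨ natR≈×1# (m ℕ.+ n) ⟩
    (m ℕ.+ n) × 1#        ≈⟨ ×-homo-+ 1# m n ⟩
    m × 1# + n × 1#       ≈⟨ +-cong (natR≈×1# m) (natR≈×1# n) ⟨
    natR R m + natR R n   ∎

  natR-homo-* : ∀ m n → natR R (m ℕ.* n) ≈ natR R m * natR R n
  natR-homo-* m n = begin
    natR R (m ℕ.* n)      ≈⟨ natR≈×1# (m ℕ.* n) ⟩
    (m ℕ.* n) × 1#        ≈⟨ ×1-homo-* m n ⟩
    m × 1# * n × 1#       ≈⟨ *-cong (natR≈×1# m) (natR≈×1# n) ⟨
    natR R m * natR R n   ∎

  intR-homo-neg : ∀ i → intR R (ℤ.- i) ≈ - intR R i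
  intR-homo-neg (+ zero) = sym ε⁻¹≈ε
  intR-homo-neg (+ suc n) = refl
  intR-homo-neg -[1+ n ] = sym (⁻¹-involutive _)

  intR-⊖ : ∀ m n → intR R (m ℤ.⊖ n) ≈ natR R m - natR R n
  intR-⊖ m zero = sym (trans (+-congˡ ε⁻¹≈ε) (+-identityʳ _))
  intR-⊖ zero (suc n) = sym (+-identityˡ _)
  intR-⊖ (suc m) (suc n) = begin
    intR R (suc m ℤ.⊖ suc n)                 ≡⟨ ≡.cong (intR R) (ℤ.[1+m]⊖[1+n]≡m⊖n m n) ⟩
    intR R (m ℤ.⊖ n)                         ≈⟨ intR-⊖ m n ⟩
    natR R m - natR R n                      ≈⟨ +-congʳ (xyx⁻¹≈y 1# (natR R m)) ⟨
    1# + natR R m - 1# - natR R n            ≈⟨ +-assoc _ _ _ ⟩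
    1# + natR R m + (- 1# - natR R n)        ≈⟨ +-congˡ (⁻¹-∙-comm 1# (natR R n)) ⟩
    1# + natR R m - (1# + natR R n)          ∎

  intR-homo-+ : ∀ i j → intR R (i ℤ.+ j) ≈ intR R i + intR R j
  intR-homo-+ (+ m) (+ n) = natR-homo-+ m n
  intR-homo-+ (+ m) -[1+ n ] = intR-⊖ m (suc n)
  intR-homo-+ -[1+ m ] (+ n) = trans (intR-⊖ n (suc m)) (+-comm _ _)
  intR-homo-+ -[1+ m ] -[1+ n ] = begin
    - (1# + natR R (suc m ℕ.+ n))          ≈⟨ -‿cong (+-congˡ (natR-homo-+ (suc m) n)) ⟩
    - (1# + (natR R (suc m) + natR R n))   ≈⟨ -‿cong (+-congˡ (+-comm _ _)) ⟩
    - (1# + (natR R n + natR R (suc m)))   ≈⟨ -‿cong (+-assoc _ _ _) ⟨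
    - (natR R (suc n) + natR R (suc m))    ≈⟨ ⁻¹-∙-comm _ _ ⟨
    - natR R (suc n) - natR R (suc m)      ≈⟨ +-comm _ _ ⟩
    - natR R (suc m) - natR R (suc n)      ∎

  intR-homo-*-pos : ∀ i n → intR R (i ℤ.* + n) ≈ intR R i * natR R n
  intR-homo-*-pos (+ m) n = trans (reflexive (≡.cong (intR R) (≡.sym (ℤ.pos-* m n)))) (natR-homo-* m n)
  intR-homo-*-pos -[1+ m ] n = begin
    intR R (ℤ.- (+ suc m) ℤ.* + n)   ≡⟨ ≡.cong (intR R) (≡.sym (ℤ.neg-distribˡ-* (+ suc m) (+ n))) ⟩
    intR R (ℤ.- (+ suc m ℤ.* + n))   ≈⟨ intR-homo-neg (+ suc m ℤ.* + n) ⟩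
    - intR R (+ suc m ℤ.* + n)       ≈⟨ -‿cong (intR-homo-*-pos (+ suc m) n) ⟩
    - (natR R (suc m) * natR R n)    ≈⟨ -‿distribˡ-* _ _ ⟩
    - natR R (suc m) * natR R n      ∎

  intR-homo-* : ∀ i j → intR R (i ℤ.* j) ≈ intR R i * intR R j
  intR-homo-* i (+ n) = intR-homo-*-pos i n
  intR-homo-* i -[1+ n ] = begin
    intR R (i ℤ.* ℤ.- (+ suc n))     ≡⟨ ≡.cong (intR R) (≡.sym (ℤ.neg-distribʳ-* i (+ suc n))) ⟩
    intR R (ℤ.- (i ℤ.* + suc n))     ≈⟨ intR-homo-neg (i ℤ.* + suc n) ⟩
    - intR R (i ℤ.* + suc n)         ≈⟨ -‿cong (intR-homo-*-pos i (suc n)) ⟩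
    - (intR R i * natR R (suc n))    ≈⟨ -‿distribʳ-* _ _ ⟩
    intR R i * - natR R (suc n)      ∎

  -- intR R (+ 1) is 1# + 0#; the solver needs a coefficient map sending + 1 to 1# on the nose.
  ι : ℤ → Carrier
  ι (+ 1) = 1#
  ι i = intR R i

  ι≈intR : ∀ i → ι i ≈ intR R i
  ι≈intR (+ 0) = refl
  ι≈intR (+ 1) = sym (+-identityʳ 1#)
  ι≈intR (+ suc (suc n)) = refl
  ι≈intR -[1+ n ] = refl

  ι-homo : ℤ.+-*-rawRing -Raw-AlmostCommutative⟶ fromCommutativeRing R
  ι-homo = record
    { ⟦_⟧ = ι
    ; +-homo = λ i j → transport (i ℤ.+ j) (intR-homo-+ i j) (+-cong (ι≈intR i) (ι≈intR j))
    ; *-homo = λ i j → transport (i ℤ.* j) (intR-homo-* i j) (*-cong (ι≈intR i) (ι≈intR j))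
    ; -‿homo = λ i → transport (ℤ.- i) (intR-homo-neg i) (-‿cong (ι≈intR i))
    ; 0-homo = refl
    ; 1-homo = refl
    }
    where
    transport : ∀ k {x y} → intR R k ≈ x → y ≈ x → ι k ≈ y
    transport k k≈x y≈x = trans (ι≈intR k) (trans k≈x (sym y≈x))

  ι-≟ : ∀ i j → Maybe (ι i ≈ ι j)
  ι-≟ i j with i ℤ.≟ j
  ... | yes ≡.refl = just refl
  ... | no _ = nothing

  module ℤ-Solver = RingSolver ℤ.+-*-rawRing (fromCommutativeRing R) ι-homo ι-≟
  open ℤ-Solver using (solve; _:=_; _:+_; _:-_; _:*_; :-_; con)

  𝟙 : ∀ {k} → ℤ-Solver.Polynomial k
  𝟙 = con (+ 1)

  sumFin≡sum : ∀ n f → sumFin R n f ≡ sum f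
  sumFin≡sum zero f = ≡.refl
  sumFin≡sum (suc n) f = ≡.cong (λ s → f zero + s) (sumFin≡sum n (λ i → f (suc i)))

  sumFin-cong : ∀ n {f g : Fin n → Carrier} → (∀ i → f i ≈ g i) → sumFin R n f ≈ sumFin R n g
  sumFin-cong n {f} {g} f≈g = begin
    sumFin R n f   ≡⟨ sumFin≡sum n f ⟩
    sum f          ≈⟨ sum-cong-≋ f≈g ⟩
    sum g          ≡⟨ ≡.sym (sumFin≡sum n g) ⟩
    sumFin R n g   ∎

  *-distribˡ-sumFin : ∀ n x (f : Fin n → Carrier) → x * sumFin R n f ≈ sumFin R n (λ i → x * f i)
  *-distribˡ-sumFin n x f = begin
    x * sumFin R n f            ≡⟨ ≡.cong (x *_) (sumFin≡sum n f) ⟩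
    x * sum f                   ≈⟨ *-distribˡ-sum x f ⟩
    sum (λ i → x * f i)         ≡⟨ ≡.sym (sumFin≡sum n (λ i → x * f i)) ⟩
    sumFin R n (λ i → x * f i)  ∎

  sumFin-comm : ∀ n (f : Fin n → Fin n → Carrier) →
    sumFin R n (λ i → sumFin R n (f i)) ≈ sumFin R n (λ j → sumFin R n (λ i → f i j))
  sumFin-comm n f = begin
    sumFin R n (λ i → sumFin R n (f i))           ≡⟨ sumFin≡sum n _ ⟩
    sum (λ i → sumFin R n (f i))                  ≡⟨ sum-cong-≗ (λ i → sumFin≡sum n (f i)) ⟩
    ∑[ i < n ] ∑[ j < n ] f i j                   ≈⟨ ∑-comm f ⟩
    ∑[ j < n ] ∑[ i < n ] f i j                   ≡⟨ ≡.sym (sum-cong-≗ (λ j → sumFin≡sum n (λ i → f i j))) ⟩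
    sum (λ j → sumFin R n (λ i → f i j))          ≡⟨ ≡.sym (sumFin≡sum n _) ⟩
    sumFin R n (λ j → sumFin R n (λ i → f i j))   ∎

  Matrix : ℕ → Set c
  Matrix n = Fin n → Fin n → Carrier

  minor : ∀ {n} → Matrix (suc n) → Fin (suc n) → Fin (suc n) → Matrix n
  minor M i j a b = M (punchIn i a) (punchIn j b)

  rowTerm : ∀ {n} → Matrix (suc n) → Fin (suc n) → Carrier
  rowTerm {n} M j = sign R (toℕ j) * (M zero j * det R n (minor M zero j))

  det-cong : ∀ n {M N : Matrix n} → (∀ i j → M i j ≈ N i j) → det R n M ≈ det R n N
  det-cong zero M≈N = refl
  det-cong (suc n) {M} {N} M≈N = sumFin-cong (suc n) {rowTerm M} {rowTerm N} λ j →
    *-congˡ (*-cong (M≈N zero j) (det-cong n (λ a b → M≈N (suc a) (punchIn j b))))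

  detᶜ : (n : ℕ) → Matrix n → Carrier
  colTerm : ∀ {n} → Matrix (suc n) → Fin (suc n) → Carrier

  detᶜ zero M = 1#
  detᶜ (suc n) M = sumFin R (suc n) (colTerm M)
  colTerm {n} M i = sign R (toℕ i) * (M i zero * detᶜ n (minor M i zero))

  det-transpose≈detᶜ : ∀ n M → det R n (λ i j → M j i) ≈ detᶜ n M
  det-transpose≈detᶜ zero M = refl
  det-transpose≈detᶜ (suc n) M = sumFin-cong (suc n) {rowTerm (λ i j → M j i)} {colTerm M} λ i →
    *-congˡ (*-congˡ (det-transpose≈detᶜ n (minor M i zero)))

  *-distribˡ-sumFin₂ : ∀ n s x (f : Fin n → Carrier) →
    s * (x * sumFin R n f) ≈ sumFin R n (λ i → s * (x * f i))
  *-distribˡ-sumFin₂ n s x f = begin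
    s * (x * sumFin R n f)               ≈⟨ *-congˡ (*-distribˡ-sumFin n x f) ⟩
    s * sumFin R n (λ i → x * f i)       ≈⟨ *-distribˡ-sumFin n s _ ⟩
    sumFin R n (λ i → s * (x * f i))     ∎

  -- Expanding the (0,0)-complementary part twice, along row 0 then column 0 or the other
  -- way round, gives the same double sum.
  det≈detᶜ-step : ∀ n → (∀ M → det R n M ≈ detᶜ n M) → (∀ M → det R (suc n) M ≈ detᶜ (suc n) M) →
    ∀ M → det R (suc (suc n)) M ≈ detᶜ (suc (suc n)) M
  det≈detᶜ-step n ih₀ ih₁ M = +-cong (*-congˡ (*-congˡ (ih₁ (minor M zero zero)))) (begin
      sumFin R (suc n) (λ j → rowTerm M (suc j))
        ≈⟨ sumFin-cong (suc n) {λ j → rowTerm M (suc j)} row-expansion ⟩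
      sumFin R (suc n) (λ j → sumFin R (suc n) (λ i → cross i j))
        ≈⟨ sumFin-comm (suc n) cross ⟨
      sumFin R (suc n) (λ i → sumFin R (suc n) (cross i))
        ≈⟨ sumFin-cong (suc n) {λ i → colTerm M (suc i)} col-expansion ⟨
      sumFin R (suc n) (λ i → colTerm M (suc i)) ∎)
    where
    N : Fin (suc n) → Fin (suc n) → Matrix n
    N = minor (minor M zero zero)

    cross : Fin (suc n) → Fin (suc n) → Carrier
    cross i j = - (sign R (toℕ i) * sign R (toℕ j) * (M (suc i) zero * M zero (suc j) * det R n (N i j)))

    row-expansion : ∀ j → rowTerm M (suc j) ≈ sumFin R (suc n) (λ i → cross i j)
    row-expansion j = begin
      rowTerm M (suc j)
        ≈⟨ *-congˡ (*-congˡ (ih₁ (minor M zero (suc j)))) ⟩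
      - sign R (toℕ j) * (M zero (suc j) * detᶜ (suc n) (minor M zero (suc j)))
        ≈⟨ *-distribˡ-sumFin₂ (suc n) _ _ (colTerm (minor M zero (suc j))) ⟩
      sumFin R (suc n) (λ i → - sign R (toℕ j) * (M zero (suc j) * colTerm (minor M zero (suc j)) i))
        ≈⟨ sumFin-cong (suc n) (λ i → trans
             (*-congˡ (*-congˡ (*-congˡ (*-congˡ (sym (ih₀ (N i j)))))))
             (solve 5 (λ s t x y d → (:- t) :* (x :* (s :* (y :* d))) := :- (s :* t :* (y :* x :* d))) refl
               (sign R (toℕ i)) (sign R (toℕ j)) (M zero (suc j)) (M (suc i) zero) (det R n (N i j)))) ⟩
      sumFin R (suc n) (λ i → cross i j) ∎

    col-expansion : ∀ i → colTerm M (suc i) ≈ sumFin R (suc n) (cross i)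
    col-expansion i = begin
      colTerm M (suc i)
        ≈⟨ *-congˡ (*-congˡ (ih₁ (minor M (suc i) zero))) ⟨
      - sign R (toℕ i) * (M (suc i) zero * det R (suc n) (minor M (suc i) zero))
        ≈⟨ *-distribˡ-sumFin₂ (suc n) _ _ (rowTerm (minor M (suc i) zero)) ⟩
      sumFin R (suc n) (λ j → - sign R (toℕ i) * (M (suc i) zero * rowTerm (minor M (suc i) zero) j))
        ≈⟨ sumFin-cong (suc n) (λ j →
             solve 5 (λ s t x y d → (:- s) :* (y :* (t :* (x :* d))) := :- (s :* t :* (y :* x :* d))) refl
               (sign R (toℕ i)) (sign R (toℕ j)) (M zero (suc j)) (M (suc i) zero) (det R n (N i j))) ⟩
      sumFin R (suc n) (cross i) ∎

  det≈detᶜ : ∀ n M → det R n M ≈ detᶜ n M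
  det≈detᶜ zero M = refl
  det≈detᶜ (suc zero) M = refl
  det≈detᶜ (suc (suc n)) = det≈detᶜ-step n (det≈detᶜ n) (det≈detᶜ (suc n))

  det-transpose : ∀ n M → det R n (λ i j → M j i) ≈ det R n M
  det-transpose n M = trans (det-transpose≈detᶜ n M) (sym (det≈detᶜ n M))

  det-neg : ∀ n M → det R n (λ i j → - M i j) ≈ sign R n * det R n M
  det-neg zero M = sym (*-identityˡ 1#)
  det-neg (suc n) M = begin
    det R (suc n) (λ i j → - M i j)
      ≈⟨ sumFin-cong (suc n) {rowTerm (λ i j → - M i j)} (λ j → trans
           (*-congˡ (*-congˡ (det-neg n (minor M zero j))))
           (solve 4 (λ t x s d → t :* (:- x :* (s :* d)) := (:- s) :* (t :* (x :* d))) refl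
             (sign R (toℕ j)) (M zero j) (sign R n) (det R n (minor M zero j)))) ⟩
    sumFin R (suc n) (λ j → - sign R n * rowTerm M j)
      ≈⟨ *-distribˡ-sumFin (suc n) (- sign R n) (rowTerm M) ⟨
    - sign R n * det R (suc n) M ∎

  sign-double : ∀ k → sign R (k ℕ.+ k) ≈ 1#
  sign-double zero = refl
  sign-double (suc k) rewrite +-suc k k = trans (⁻¹-involutive _) (sign-double k)

  sign-odd : ∀ {n} → Odd n → sign R n ≈ - 1#
  sign-odd (k , ≡.refl) = -‿cong (sign-double k)

  det-skewSymmetric-odd : ∀ {n} → Odd n → (M : Matrix n) → (∀ i j → M j i ≈ - M i j) →
    det R n M ≈ - det R n M
  det-skewSymmetric-odd {n} odd M skew = begin
    det R n M                      ≈⟨ det-transpose n M ⟨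
    det R n (λ i j → M j i)        ≈⟨ det-cong n skew ⟩
    det R n (λ i j → - M i j)      ≈⟨ det-neg n M ⟩
    sign R n * det R n M           ≈⟨ *-congʳ (sign-odd odd) ⟩
    - 1# * det R n M               ≈⟨ -1*x≈-x _ ⟩
    - det R n M                    ∎

  skewPart : ∀ {n} → Matrix n → Matrix n
  skewPart M zero zero = 0#
  skewPart M zero (suc j) = M zero (suc j)
  skewPart M (suc i) zero = - M zero (suc i)
  skewPart M (suc i) (suc j) = skewPart (minor M zero zero) i j

  skewPart-skew : ∀ {n} (M : Matrix n) i j → skewPart M j i ≈ - skewPart M i j
  skewPart-skew M zero zero = sym ε⁻¹≈ε
  skewPart-skew M zero (suc j) = refl
  skewPart-skew M (suc i) zero = sym (⁻¹-involutive _)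
  skewPart-skew M (suc i) (suc j) = skewPart-skew (minor M zero zero) i j

  pow≡^ : ∀ x k → pow R x k ≡ x ^ k
  pow≡^ x zero = ≡.refl
  pow≡^ x (suc k) = ≡.cong (x *_) (pow≡^ x k)

  pow-homo-+ : ∀ x k m → pow R x (k ℕ.+ m) ≈ pow R x k * pow R x m
  pow-homo-+ x k m = begin
    pow R x (k ℕ.+ m)       ≡⟨ pow≡^ x (k ℕ.+ m) ⟩
    x ^ (k ℕ.+ m)           ≈⟨ ^-homo-* x k m ⟩
    x ^ k * x ^ m           ≡⟨ ≡.sym (≡.cong₂ _*_ (pow≡^ x k) (pow≡^ x m)) ⟩
    pow R x k * pow R x m   ∎

  pow-distrib-* : ∀ x y k → pow R (x * y) k ≈ pow R x k * pow R y k
  pow-distrib-* x y k = begin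
    pow R (x * y) k         ≡⟨ pow≡^ (x * y) k ⟩
    (x * y) ^ k             ≈⟨ ^-distrib-* x y k ⟩
    x ^ k * y ^ k           ≡⟨ ≡.sym (≡.cong₂ _*_ (pow≡^ x k) (pow≡^ y k)) ⟩
    pow R x k * pow R y k   ∎

  geom : Carrier → ℕ → Carrier
  geom x zero = 0#
  geom x (suc k) = 1# + x * geom x k

  geom-telescope : ∀ x k → (1# - x) * geom x k ≈ 1# - pow R x k
  geom-telescope x zero = trans (zeroʳ _) (sym (-‿inverseʳ 1#))
  geom-telescope x (suc k) = begin
    (1# - x) * (1# + x * geom x k)
      ≈⟨ solve 2 (λ x g → (𝟙 :- x) :* (𝟙 :+ x :* g) := (𝟙 :- x) :+ x :* ((𝟙 :- x) :* g)) refl x (geom x k) ⟩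
    (1# - x) + x * ((1# - x) * geom x k)
      ≈⟨ +-congˡ (*-congˡ (geom-telescope x k)) ⟩
    (1# - x) + x * (1# - pow R x k)
      ≈⟨ solve 2 (λ x p → (𝟙 :- x) :+ x :* (𝟙 :- p) := 𝟙 :- x :* p) refl x (pow R x k) ⟩
    1# - x * pow R x k ∎

  geom-+ : ∀ x k m → geom x (k ℕ.+ m) ≈ geom x k + pow R x k * geom x m
  geom-+ x zero m = sym (trans (+-identityˡ _) (*-identityˡ _))
  geom-+ x (suc k) m = trans (+-congˡ (*-congˡ (geom-+ x k m)))
    (solve 4 (λ x g p h → 𝟙 :+ x :* (g :+ p :* h) := (𝟙 :+ x :* g) :+ (x :* p) :* h) refl
      x (geom x k) (pow R x k) (geom x m))

  addPoly : List ℤ → List ℤ → List ℤ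
  addPoly [] q = q
  addPoly (a ∷ p) [] = a ∷ p
  addPoly (a ∷ p) (b ∷ q) = a ℤ.+ b ∷ addPoly p q

  scalePoly : ℤ → List ℤ → List ℤ
  scalePoly a [] = []
  scalePoly a (b ∷ q) = a ℤ.* b ∷ scalePoly a q

  module Ideal (ζ : Carrier) where

    evalPoly-addPoly : ∀ p q → evalPoly R (addPoly p q) ζ ≈ evalPoly R p ζ + evalPoly R q ζ
    evalPoly-addPoly [] q = sym (+-identityˡ _)
    evalPoly-addPoly (a ∷ p) [] = sym (+-identityʳ _)
    evalPoly-addPoly (a ∷ p) (b ∷ q) = trans
      (+-cong (intR-homo-+ a b) (*-congˡ (evalPoly-addPoly p q)))
      (solve 5 (λ x y z u v → (x :+ y) :+ z :* (u :+ v) := (x :+ z :* u) :+ (y :+ z :* v)) refl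
        (intR R a) (intR R b) ζ (evalPoly R p ζ) (evalPoly R q ζ))

    evalPoly-scalePoly : ∀ a q → evalPoly R (scalePoly a q) ζ ≈ intR R a * evalPoly R q ζ
    evalPoly-scalePoly a [] = sym (zeroʳ _)
    evalPoly-scalePoly a (b ∷ q) = trans
      (+-cong (intR-homo-* a b) (*-congˡ (evalPoly-scalePoly a q)))
      (solve 4 (λ x y z u → x :* y :+ z :* (x :* u) := x :* (y :+ z :* u)) refl
        (intR R a) (intR R b) ζ (evalPoly R q ζ))

    InZζ-cong : ∀ {x y} → x ≈ y → InZζ R ζ y → InZζ R ζ x
    InZζ-cong x≈y (p , y≈p) = p , trans x≈y y≈p

    InZζ-0 : InZζ R ζ 0#
    InZζ-0 = [] , refl

    InZζ-1 : InZζ R ζ 1#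
    InZζ-1 = + 1 ∷ [] , solve 1 (λ z → 𝟙 := (𝟙 :+ con (+ 0)) :+ z :* con (+ 0)) refl ζ

    InZζ-ζ* : ∀ {x} → InZζ R ζ x → InZζ R ζ (ζ * x)
    InZζ-ζ* (p , x≈p) = + 0 ∷ p , trans (*-congˡ x≈p) (sym (+-identityˡ _))

    InZζ-ζ : InZζ R ζ ζ
    InZζ-ζ = InZζ-cong (sym (*-identityʳ ζ)) (InZζ-ζ* InZζ-1)

    InZζ-+ : ∀ {x y} → InZζ R ζ x → InZζ R ζ y → InZζ R ζ (x + y)
    InZζ-+ (p , x≈p) (q , y≈q) = addPoly p q , trans (+-cong x≈p y≈q) (sym (evalPoly-addPoly p q))

    InZζ-intR* : ∀ a {x} → InZζ R ζ x → InZζ R ζ (intR R a * x)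
    InZζ-intR* a (p , x≈p) = scalePoly a p , trans (*-congˡ x≈p) (sym (evalPoly-scalePoly a p))

    InZζ-neg : ∀ {x} → InZζ R ζ x → InZζ R ζ (- x)
    InZζ-neg {x} x∈ = InZζ-cong
      (solve 1 (λ x → :- x := (:- (𝟙 :+ con (+ 0))) :* x) refl x) (InZζ-intR* -[1+ 0 ] x∈)

    InZζ-* : ∀ {x y} → InZζ R ζ x → InZζ R ζ y → InZζ R ζ (x * y)
    InZζ-* {y = y} (p , x≈p) y∈ = InZζ-cong (*-congʳ x≈p) (evalPoly-* p)
      where
      evalPoly-* : ∀ p → InZζ R ζ (evalPoly R p ζ * y)
      evalPoly-* [] = InZζ-cong (zeroˡ y) InZζ-0
      evalPoly-* (a ∷ p) = InZζ-cong (trans (distribʳ y _ _) (+-congˡ (*-assoc ζ _ y)))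
        (InZζ-+ (InZζ-intR* a y∈) (InZζ-ζ* (evalPoly-* p)))

    InZζ-sumFin : ∀ n {f : Fin n → Carrier} → (∀ i → InZζ R ζ (f i)) → InZζ R ζ (sumFin R n f)
    InZζ-sumFin zero f∈ = InZζ-0
    InZζ-sumFin (suc n) f∈ = InZζ-+ (f∈ zero) (InZζ-sumFin n (λ i → f∈ (suc i)))

    InZζ-sign : ∀ k → InZζ R ζ (sign R k)
    InZζ-sign zero = InZζ-1
    InZζ-sign (suc k) = InZζ-neg (InZζ-sign k)

    InZζ-det : ∀ n {M : Matrix n} → (∀ i j → InZζ R ζ (M i j)) → InZζ R ζ (det R n M)
    InZζ-det zero M∈ = InZζ-1
    InZζ-det (suc n) M∈ = InZζ-sumFin (suc n) λ j →
      InZζ-* (InZζ-sign (toℕ j)) (InZζ-* (M∈ zero j) (InZζ-det n (λ a b → M∈ (suc a) (punchIn j b))))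

    InIdeal-cong : ∀ {x y} → x ≈ y → InIdeal R ζ y → InIdeal R ζ x
    InIdeal-cong x≈y (p , y≈p) = p , trans x≈y y≈p

    InIdeal-intro : ∀ {w} → InZζ R ζ w → InIdeal R ζ ((1# - ζ) * w)
    InIdeal-intro (p , w≈p) = p , *-congˡ w≈p

    InIdeal-0 : InIdeal R ζ 0#
    InIdeal-0 = [] , sym (zeroʳ _)

    InIdeal-+ : ∀ {x y} → InIdeal R ζ x → InIdeal R ζ y → InIdeal R ζ (x + y)
    InIdeal-+ (p , x≈p) (q , y≈q) = InIdeal-cong
      (trans (+-cong x≈p y≈q) (sym (distribˡ _ _ _))) (InIdeal-intro (InZζ-+ (p , refl) (q , refl)))

    InIdeal-*ˡ : ∀ {x y} → InZζ R ζ x → InIdeal R ζ y → InIdeal R ζ (x * y)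
    InIdeal-*ˡ {x} x∈ (p , y≈p) = InIdeal-cong
      (trans (*-congˡ y≈p) (solve 3 (λ x z w → x :* ((𝟙 :- z) :* w) := (𝟙 :- z) :* (x :* w)) refl x ζ _))
      (InIdeal-intro (InZζ-* x∈ (p , refl)))

    InZζ-skewPart : ∀ {n} {M : Matrix n} → (∀ i j → InZζ R ζ (M i j)) → ∀ i j → InZζ R ζ (skewPart M i j)
    InZζ-skewPart M∈ zero zero = InZζ-0
    InZζ-skewPart M∈ zero (suc j) = M∈ zero (suc j)
    InZζ-skewPart M∈ (suc i) zero = InZζ-neg (M∈ zero (suc i))
    InZζ-skewPart M∈ (suc i) (suc j) = InZζ-skewPart (λ a b → M∈ (suc a) (suc b)) i j

    infix 4 _≈ᴵ_
    _≈ᴵ_ : Carrier → Carrier → Set ℓ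
    x ≈ᴵ y = InIdeal R ζ (x - y)

    ≈ᴵ-refl : ∀ {x} → x ≈ᴵ x
    ≈ᴵ-refl = InIdeal-cong (-‿inverseʳ _) InIdeal-0

    +-congᴵ : ∀ {x y u v} → x ≈ᴵ y → u ≈ᴵ v → x + u ≈ᴵ y + v
    +-congᴵ {x} {y} {u} {v} x≈y u≈v = InIdeal-cong
      (solve 4 (λ x y u v → (x :+ u) :- (y :+ v) := (x :- y) :+ (u :- v)) refl x y u v)
      (InIdeal-+ x≈y u≈v)

    *-congᴵ : ∀ {x y u v} → InZζ R ζ x → InZζ R ζ v → x ≈ᴵ y → u ≈ᴵ v → x * u ≈ᴵ y * v
    *-congᴵ {x} {y} {u} {v} x∈ v∈ x≈y u≈v = InIdeal-cong
      (solve 4 (λ x y u v → x :* u :- y :* v := x :* (u :- v) :+ v :* (x :- y)) refl x y u v)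
      (InIdeal-+ (InIdeal-*ˡ x∈ u≈v) (InIdeal-*ˡ v∈ x≈y))

    sumFin-congᴵ : ∀ n {f g : Fin n → Carrier} → (∀ i → f i ≈ᴵ g i) → sumFin R n f ≈ᴵ sumFin R n g
    sumFin-congᴵ zero f≈g = ≈ᴵ-refl
    sumFin-congᴵ (suc n) f≈g = +-congᴵ (f≈g zero) (sumFin-congᴵ n (λ i → f≈g (suc i)))

    det-congᴵ : ∀ n {M N : Matrix n} → (∀ i j → InZζ R ζ (M i j)) → (∀ i j → InZζ R ζ (N i j)) →
      (∀ i j → M i j ≈ᴵ N i j) → det R n M ≈ᴵ det R n N
    det-congᴵ zero M∈ N∈ M≈N = ≈ᴵ-refl
    det-congᴵ (suc n) {M} {N} M∈ N∈ M≈N = sumFin-congᴵ (suc n) {rowTerm M} {rowTerm N} λ j →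
      *-congᴵ (InZζ-sign (toℕ j)) (InZζ-* (N∈ zero j) (InZζ-det n (minor-∈ N∈ j))) ≈ᴵ-refl
        (*-congᴵ (M∈ zero j) (InZζ-det n (minor-∈ N∈ j)) (M≈N zero j)
          (det-congᴵ n (minor-∈ M∈ j) (minor-∈ N∈ j) (λ a b → M≈N (suc a) (punchIn j b))))
      where
      minor-∈ : ∀ {K : Matrix (suc n)} → (∀ i j → InZζ R ζ (K i j)) → ∀ j a b → InZζ R ζ (minor K zero j a b)
      minor-∈ K∈ j a b = K∈ (suc a) (punchIn j b)

    ≈ᴵ-skewPart : ∀ {n} {M : Matrix n} → (∀ i → InIdeal R ζ (M i i)) →
      (∀ i j → InIdeal R ζ (M i j + M j i)) → ∀ i j → M i j ≈ᴵ skewPart M i j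
    ≈ᴵ-skewPart diag∈ sym∈ zero zero = InIdeal-cong (trans (+-congˡ ε⁻¹≈ε) (+-identityʳ _)) (diag∈ zero)
    ≈ᴵ-skewPart diag∈ sym∈ zero (suc j) = ≈ᴵ-refl
    ≈ᴵ-skewPart diag∈ sym∈ (suc i) zero = InIdeal-cong (+-congˡ (⁻¹-involutive _)) (sym∈ (suc i) zero)
    ≈ᴵ-skewPart diag∈ sym∈ (suc i) (suc j) =
      ≈ᴵ-skewPart (λ a → diag∈ (suc a)) (λ a b → sym∈ (suc a) (suc b)) i j

    InZζ-geom : ∀ {x} → InZζ R ζ x → ∀ k → InZζ R ζ (geom x k)
    InZζ-geom x∈ zero = InZζ-0
    InZζ-geom x∈ (suc k) = InZζ-+ InZζ-1 (InZζ-* x∈ (InZζ-geom x∈ k))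

    -- Termwise ζ^(2i) ≡ ζ^i modulo 1 - ζ.
    geom≈ᴵgeom² : ∀ k → geom ζ k ≈ᴵ geom (ζ * ζ) k
    geom≈ᴵgeom² zero = ≈ᴵ-refl
    geom≈ᴵgeom² (suc k) = InIdeal-cong
      (solve 3 (λ z g e → (𝟙 :+ z :* g) :- (𝟙 :+ (z :* z) :* e) := z :* (g :- e) :+ (𝟙 :- z) :* (z :* e)) refl
        ζ (geom ζ k) (geom (ζ * ζ) k))
      (InIdeal-+ (InIdeal-*ˡ InZζ-ζ (geom≈ᴵgeom² k))
        (InIdeal-intro (InZζ-* InZζ-ζ (InZζ-geom (InZζ-* InZζ-ζ InZζ-ζ) k))))

    ≈ᴵ-zero⇒InIdeal : ∀ {x y} → x ≈ᴵ y → y ≈ 0# → InIdeal R ζ x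
    ≈ᴵ-zero⇒InIdeal x≈y y≈0 = InIdeal-cong
      (trans (sym (+-identityʳ _)) (+-congˡ (trans (sym ε⁻¹≈ε) (-‿cong (sym y≈0))))) x≈y

  module _ (noZeroDivisors : NoZeroDivisors R) where

    *-cancelˡ-nonzero : ∀ {u x y} → ¬ (u ≈ 0#) → u * x ≈ u * y → x ≈ y
    *-cancelˡ-nonzero {u} {x} {y} u≉0 ux≈uy with noZeroDivisors u (x - y) (begin
      u * (x - y)       ≈⟨ distribˡ u x (- y) ⟩
      u * x + u * - y   ≈⟨ +-congˡ (-‿distribʳ-* u y) ⟨
      u * x - u * y     ≈⟨ x≈y⇒x∙y⁻¹≈ε ux≈uy ⟩
      0#                ∎)
    ... | inj₁ u≈0 = ⊥-elim (u≉0 u≈0)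
    ... | inj₂ x-y≈0 = x∙y⁻¹≈ε⇒x≈y x y x-y≈0

    nonzero-*-≈0 : ∀ {u x} → ¬ (u ≈ 0#) → u * x ≈ 0# → x ≈ 0#
    nonzero-*-≈0 u≉0 ux≈0 = *-cancelˡ-nonzero u≉0 (trans ux≈0 (sym (zeroʳ _)))

    x≈-x⇒x≈0 : CharZero R → ∀ {x} → x ≈ - x → x ≈ 0#
    x≈-x⇒x≈0 charZero {x} x≈-x = nonzero-*-≈0 (charZero 1) (begin
      (1# + (1# + 0#)) * x    ≈⟨ *-congʳ (+-congˡ (+-identityʳ 1#)) ⟩
      (1# + 1#) * x           ≈⟨ distribʳ x 1# 1# ⟩
      1# * x + 1# * x         ≈⟨ +-cong (*-identityˡ x) (*-identityˡ x) ⟩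
      x + x                   ≈⟨ +-congˡ x≈-x ⟩
      x - x                   ≈⟨ -‿inverseʳ x ⟩
      0#                      ∎)

    geom-vanishes : ∀ {x} k → ¬ (1# - x ≈ 0#) → pow R x k ≈ 1# → geom x k ≈ 0#
    geom-vanishes {x} k 1-x≉0 xᵏ≈1 = nonzero-*-≈0 1-x≉0 (begin
      (1# - x) * geom x k   ≈⟨ geom-telescope x k ⟩
      1# - pow R x k        ≈⟨ x≈y⇒x∙y⁻¹≈ε (sym xᵏ≈1) ⟩
      0#                    ∎)

    -- M is congruent to its skewPart, whose determinant d satisfies d = - d.
    det-InIdeal-odd : CharZero R → (ζ : Carrier) → ∀ {n} → Odd n → (M : Matrix n) →
      (∀ i j → InZζ R ζ (M i j)) → (∀ i → InIdeal R ζ (M i i)) →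
      (∀ i j → InIdeal R ζ (M i j + M j i)) → InIdeal R ζ (det R n M)
    det-InIdeal-odd charZero ζ {n} odd M M∈ diag∈ sym∈ =
      ≈ᴵ-zero⇒InIdeal (det-congᴵ n M∈ (InZζ-skewPart M∈) (≈ᴵ-skewPart diag∈ sym∈))
        (x≈-x⇒x≈0 charZero (det-skewSymmetric-odd odd (skewPart M) (skewPart-skew M)))
      where open Ideal ζ

    module Primitive {q} (ζ : Carrier) (ζ-primitive : PrimitiveRoot R q ζ) (2<q : 2 < q) where
      open Ideal ζ

      1-ζᵏ≉0 : ∀ {k} → 0 < k → k < q → ¬ (1# - pow R ζ k ≈ 0#)
      1-ζᵏ≉0 0<k k<q 1-ζᵏ≈0 = proj₂ ζ-primitive _ 0<k k<q (sym (x∙y⁻¹≈ε⇒x≈y 1# _ 1-ζᵏ≈0))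

      1-ζ≉0 : ¬ (1# - ζ ≈ 0#)
      1-ζ≉0 1-ζ≈0 = 1-ζᵏ≉0 (s≤s z≤n) (<-trans (s≤s (s≤s z≤n)) 2<q)
        (trans (+-congˡ (-‿cong (*-identityʳ ζ))) 1-ζ≈0)

      1-ζ²≉0 : ¬ (1# - ζ * ζ ≈ 0#)
      1-ζ²≉0 1-ζ²≈0 = 1-ζᵏ≉0 (s≤s z≤n) 2<q
        (trans (+-congˡ (-‿cong (*-congˡ (*-identityʳ ζ)))) 1-ζ²≈0)

      geom-unique : ∀ {a} k → (1# - ζ) * a ≈ 1# - pow R ζ k → a ≈ geom ζ k
      geom-unique k e = *-cancelˡ-nonzero 1-ζ≉0 (trans e (sym (geom-telescope ζ k)))

      geom-InIdeal : ∀ k → pow R ζ k * pow R ζ k ≈ 1# → InIdeal R ζ (geom ζ k)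
      geom-InIdeal k ζᵏζᵏ≈1 = ≈ᴵ-zero⇒InIdeal (geom≈ᴵgeom² k)
        (geom-vanishes k 1-ζ²≉0 (trans (pow-distrib-* ζ ζ k) ζᵏζᵏ≈1))

      geom+geom-InIdeal : ∀ k m → pow R ζ m * pow R ζ k ≈ 1# → InIdeal R ζ (geom ζ k + geom ζ m)
      geom+geom-InIdeal k m ζᵐζᵏ≈1 = InIdeal-cong (begin
        geom ζ k + geom ζ m
          ≈⟨ solve 3 (λ g h p → g :+ h := (𝟙 :- p) :* h :+ (g :+ p :* h)) refl (geom ζ k) (geom ζ m) (pow R ζ k) ⟩
        (1# - pow R ζ k) * geom ζ m + (geom ζ k + pow R ζ k * geom ζ m)
          ≈⟨ +-cong (*-congʳ (geom-telescope ζ k)) (geom-+ ζ k m) ⟨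
        (1# - ζ) * geom ζ k * geom ζ m + geom ζ (k ℕ.+ m)    ≈⟨ +-congˡ geom-k+m≈0 ⟩
        (1# - ζ) * geom ζ k * geom ζ m + 0#                  ≈⟨ +-identityʳ _ ⟩
        (1# - ζ) * geom ζ k * geom ζ m                       ≈⟨ *-assoc _ _ _ ⟩
        (1# - ζ) * (geom ζ k * geom ζ m)                     ∎)
        (InIdeal-intro (InZζ-* (InZζ-geom InZζ-ζ k) (InZζ-geom InZζ-ζ m)))
        where
        geom-k+m≈0 : geom ζ (k ℕ.+ m) ≈ 0#
        geom-k+m≈0 = geom-vanishes (k ℕ.+ m) 1-ζ≉0 (trans (pow-homo-+ ζ k m) (trans (*-comm _ _) ζᵐζᵏ≈1))

lemma4p1 : {c ℓ : Level} (R : CommutativeRing c ℓ) →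
    CharZero R → NoZeroDivisors R →
    (n q : ℕ) → Odd n → 2 < q →
    (ζ : CommutativeRing.Carrier R) → PrimitiveRoot R q ζ →
    (H : Fin n → Fin n → CommutativeRing.Carrier R) → InH R n q ζ H →
    (A : Fin n → Fin n → CommutativeRing.Carrier R) →
    (∀ i j → CommutativeRing._≈_ R
               (CommutativeRing._*_ R (CommutativeRing._-_ R (CommutativeRing.1# R) ζ) (A i j))
               (CommutativeRing._-_ R (CommutativeRing.1# R) (H i j))) →
    InIdeal R ζ (det R n A)
lemma4p1 R charZero noZeroDivisors n q odd 2<q ζ ζ-primitive H (H-pow , H-hermitian) A A-def =
  det-InIdeal-odd R noZeroDivisors charZero ζ odd A A∈ diag∈ sym∈
  where
  open CommutativeRing R
  open Ideal R ζ
  open Primitive R noZeroDivisors ζ ζ-primitive 2<q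

  k : Fin n → Fin n → ℕ
  k i j = proj₁ (H-pow i j)

  H≈ζᵏ : ∀ i j → H i j ≈ pow R ζ (k i j)
  H≈ζᵏ i j = proj₂ (H-pow i j)

  A≈geom : ∀ i j → A i j ≈ geom R ζ (k i j)
  A≈geom i j = geom-unique (k i j) (trans (A-def i j) (+-congˡ (-‿cong (H≈ζᵏ i j))))

  ζ-conjugate : ∀ i j → pow R ζ (k j i) * pow R ζ (k i j) ≈ 1#
  ζ-conjugate i j = trans (*-congʳ (sym (H≈ζᵏ j i))) (H-hermitian i j (k i j) (H≈ζᵏ i j))

  A∈ : ∀ i j → InZζ R ζ (A i j)
  A∈ i j = InZζ-cong (A≈geom i j) (InZζ-geom InZζ-ζ (k i j))

  diag∈ : ∀ i → InIdeal R ζ (A i i)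
  diag∈ i = InIdeal-cong (A≈geom i i) (geom-InIdeal (k i i) (ζ-conjugate i i))

  sym∈ : ∀ i j → InIdeal R ζ (A i j + A j i)
  sym∈ i j = InIdeal-cong (+-cong (A≈geom i j) (A≈geom j i))
    (geom+geom-InIdeal (k i j) (k j i) (ζ-conjugate i j))
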